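{- Let $m,n,s,k$ be integers with $4\leq s\leq n$, $4\leq k\leq m$, $ms=nk$ and $s\equiv k\equiv 0\pmod 4$. Then there exists an integer $\mathcal{H}_t(m,n;s,k)$ for any divisor $t$ of $ms$ such that $t\equiv 0\pmod 4$.
   Context: A partially filled (p.f.) array is an array in which some cells are filled and the others are empty. Let $v=2ms+t$ where $t$ divides $2ms$, and let $J$ be the subgroup of order $t$ of $\mathbb{Z}_v$. A Heffter array $\mathcal{H}_t(m,n;s,k)$ over $\mathbb{Z}_v$ relative to $J$ is an $m\times n$ p.f. array with elements in $\mathbb{Z}_v$ such that: (a) each row contains exactly $s$ filled cells and each column exactly $k$ filled cells; (b) for every $x\in\mathbb{Z}_v\setminus J$, either $x$ or $-x$ appears in the array; (c) the elements in every row and column sum to $0$. It is integer if the elements of every row and every column, viewed as integers in $\pm\{1,\ldots,\lfloor v/2\rfloor\}$, sum to $0$ in $\mathbb{Z}$. -}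

module Defs where

open import Data.Nat as ℕ using (ℕ; _*_; _+_; _≤_; _/_)
open import Data.Integer as ℤ using (ℤ; +_; ∣_∣)
open import Data.Integer.Divisibility as ℤD using ()
open import Data.Nat.Divisibility as ℕD using ()
open import Data.Fin using (Fin)
open import Data.List using (List; length; foldr; mapMaybe; allFin)
open import Data.Maybe using (Maybe; just)
open import Data.Product using (Σ; ∃; _×_)
open import Data.Sum using (_⊎_)
open import Relation.Binary.PropositionalEquality using (_≡_)
open import Relation.Nullary using (¬_)

PFArray : ℕ → ℕ → Set
PFArray m n = Fin m → Fin n → Maybe ℤ

rowEntries : ∀ {m n} → PFArray m n → Fin m → List ℤ
rowEntries {n = n} A i = mapMaybe (λ j → A i j) (allFin n)

colEntries : ∀ {m n} → PFArray m n → Fin n → List ℤ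
colEntries {m = m} A j = mapMaybe (λ i → A i j) (allFin m)

sumℤ : List ℤ → ℤ
sumℤ = foldr ℤ._+_ (+ 0)

_≡_[mod_] : ℤ → ℤ → ℕ → Set
a ≡ b [mod v ] = (+ v) ℤD.∣ (a ℤ.- b)

-- x ∈ ℤ_v (represented by 0 ≤ x < v) lies in the (unique) subgroup J of
-- order t of ℤ_v, i.e. t·x ≡ 0 (mod v).
InJ : (v t x : ℕ) → Set
InJ v t x = v ℕD.∣ (t * x)

-- Elements of ℤ_v are written as their integer representatives in
-- ±{1,…,⌊v/2⌋}; the row and column sums vanish in ℤ (integer condition,
-- which implies (c) in ℤ_v).
record IntegerHeffter (m n s k t : ℕ) : Set where
  field
    array : PFArray m n
  v : ℕ
  v = 2 * m * s + t
  field
    entries-range : ∀ i j e → array i j ≡ just e → 1 ≤ ∣ e ∣ × ∣ e ∣ ≤ v / 2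
    row-filled : ∀ i → length (rowEntries array i) ≡ s
    col-filled : ∀ j → length (colEntries array j) ≡ k
    covers : ∀ x → x ℕ.< v → ¬ InJ v t x →
      ∃ λ i → ∃ λ j → ∃ λ e → array i j ≡ just e ×
        (e ≡ (+ x) [mod v ] ⊎ e ≡ ℤ.- (+ x) [mod v ])
    row-sum : ∀ i → sumℤ (rowEntries array i) ≡ + 0
    col-sum : ∀ j → sumℤ (colEntries array j) ≡ + 0

-- Write s = 4σ, k = 4κ, t = 4τ and mσ = τq.  Then v = 4τd with d = 2q + 1, and J consists of
-- the multiples of d.  The integers of [1, 2τd) not divisible by d are split into mσ
-- quadruples (x, −(x+1), −(y+K), y+K+1) with K = τd, each summing to 0, where x and y run
-- over the numbers 1 + jd + 2h (j < τ, h < q).  Row i holds the quadruples iσ, …, iσ+σ−1,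
-- spread over the 4σ cyclically consecutive columns starting at column iσ so that their r-th
-- entries fill the r-th block of σ columns.  The y of a quadruple is taken from the quadruple
-- 2σ further on inside its block of n (the map β), so that every column consists of κ sums
-- x − (x′+1) − (x+K) + (x′+K+1) = 0.
module Submission where

open import Defs
open import Data.Nat using (ℕ; _*_; _≤_)
open import Data.Nat.Divisibility using (_∣_)
open import Relation.Binary.PropositionalEquality using (_≡_)

open import Algebra.Properties.CommutativeSemigroup as CommSemigroupProperties using ()
open import Data.Bool using (Bool; true; false; if_then_else_)
open import Data.Bool.Properties using (T-≡)
open import Data.Fin using (Fin; toℕ; fromℕ<)
open import Data.Fin.Properties using (toℕ-fromℕ<; toℕ<n)
open import Data.Integer as ℤ using (ℤ; +_; -_; 0ℤ; 1ℤ) renaming (_+_ to _+ℤ_)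
import Data.Integer.Properties as ℤP
open import Data.Integer.Tactic.RingSolver renaming (solve-∀ to solveℤ-∀)
open import Data.List using (length; tabulate; catMaybes; mapMaybe; allFin)
open import Data.List.Properties using (map-tabulate)
open import Data.Maybe using (Maybe; just; nothing; fromMaybe)
open import Data.Nat using (zero; suc; _+_; _∸_; _<_; _≡ᵇ_; _<ᵇ_; z≤n; s≤s; z<s; s<s; s<s⁻¹; NonZero; >-nonZero)
open import Data.Nat.Divisibility using (divides; ∣-refl; _∣0; n∣m*n; ∣m∣n⇒∣m+n; ∣m+n∣m⇒∣n; m%n≡0⇒n∣m)
open import Data.Nat.DivMod
open import Data.Nat.Properties
open import Data.Nat.Tactic.RingSolver using (solve-∀)
open import Data.Product using (∃; _×_; _,_; proj₁; proj₂)
open import Data.Sum using (_⊎_; inj₁; inj₂)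
open import Function using (_∘_; _⇔_; mk⇔; Equivalence)
open import Function.Properties.Equivalence using () renaming (sym to ⇔-sym)
open import Relation.Binary.PropositionalEquality using (refl; sym; trans; cong; cong₂; subst; subst₂; module ≡-Reasoning)
open import Relation.Binary.Definitions using (tri<; tri≈; tri>)
open import Relation.Nullary using (¬_; yes; no; contradiction)

open CommSemigroupProperties +-commutativeSemigroup using (xy∙z≈xz∙y; xy∙z≈zy∙x)
open CommSemigroupProperties ℤP.+-commutativeSemigroup using () renaming (interchange to +ℤ-interchange)

radix-< : ∀ {j h τ q} → j < τ → h < q → j * q + h < τ * q
radix-< {j} {h} {τ} {q} j<τ h<q = begin-strict
  j * q + h <⟨ +-monoʳ-< (j * q) h<q ⟩
  j * q + q ≡⟨ +-comm (j * q) q ⟩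
  suc j * q ≤⟨ *-monoˡ-≤ q j<τ ⟩
  τ * q     ∎
  where open ≤-Reasoning

[m*n+o]%n≡o : ∀ m {n o} .{{_ : NonZero n}} → o < n → (m * n + o) % n ≡ o
[m*n+o]%n≡o m {n} {o} o<n = begin
  (m * n + o) % n ≡⟨ cong (_% n) (+-comm (m * n) o) ⟩
  (o + m * n) % n ≡⟨ [m+kn]%n≡m%n o m n ⟩
  o % n           ≡⟨ m<n⇒m%n≡m o<n ⟩
  o               ∎
  where open ≡-Reasoning

[m*n+o]/n≡m : ∀ m {n o} .{{_ : NonZero n}} → o < n → (m * n + o) / n ≡ m
[m*n+o]/n≡m m {n} {o} o<n = begin
  (m * n + o) / n     ≡⟨ +-distrib-/-∣ˡ o (n∣m*n m) ⟩
  m * n / n + o / n   ≡⟨ cong₂ _+_ (m*n/n≡m m n) (m<n⇒m/n≡0 o<n) ⟩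
  m + 0               ≡⟨ +-identityʳ m ⟩
  m                   ∎
  where open ≡-Reasoning

*4-cancel : ∀ a b c e → a * (b * 4) ≡ c * (e * 4) → a * b ≡ e * c
*4-cancel a b c e eq = *-cancelʳ-≡ (a * b) (e * c) 4 (begin
  a * b * 4   ≡⟨ *-assoc a b 4 ⟩
  a * (b * 4) ≡⟨ eq ⟩
  c * (e * 4) ≡⟨ *-assoc c e 4 ⟨
  c * e * 4   ≡⟨ cong (_* 4) (*-comm c e) ⟩
  e * c * 4   ∎)
  where open ≡-Reasoning

+1-comm : ∀ x y → x + y + 1 ≡ suc x + y
+1-comm = solve-∀

∑ : ℕ → (ℕ → ℤ) → ℤ
∑ zero    f = 0ℤ
∑ (suc N) f = f 0 +ℤ ∑ N (λ x → f (suc x))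

∑-cong-< : ∀ N {f g : ℕ → ℤ} → (∀ x → x < N → f x ≡ g x) → ∑ N f ≡ ∑ N g
∑-cong-< zero    f≡g = refl
∑-cong-< (suc N) f≡g = cong₂ _+ℤ_ (f≡g 0 z<s) (∑-cong-< N (λ x x<N → f≡g (suc x) (s<s x<N)))

∑-cong : ∀ N {f g : ℕ → ℤ} → (∀ x → f x ≡ g x) → ∑ N f ≡ ∑ N g
∑-cong N f≡g = ∑-cong-< N (λ x _ → f≡g x)

∑-zero : ∀ N → ∑ N (λ _ → 0ℤ) ≡ 0ℤ
∑-zero zero    = refl
∑-zero (suc N) = trans (ℤP.+-identityˡ _) (∑-zero N)

∑-const : ∀ N c → ∑ N (λ _ → + c) ≡ + (N * c)
∑-const zero    c = refl
∑-const (suc N) c = cong (+ c +ℤ_) (∑-const N c)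

∑-distrib-+ : ∀ N (f g : ℕ → ℤ) → ∑ N (λ x → f x +ℤ g x) ≡ ∑ N f +ℤ ∑ N g
∑-distrib-+ zero    f g = refl
∑-distrib-+ (suc N) f g =
  trans (cong ((f 0 +ℤ g 0) +ℤ_) (∑-distrib-+ N _ _)) (+ℤ-interchange (f 0) (g 0) _ _)

∑-split-+ : ∀ a b (f : ℕ → ℤ) → ∑ (a + b) f ≡ ∑ a f +ℤ ∑ b (λ x → f (a + x))
∑-split-+ zero    b f = sym (ℤP.+-identityˡ _)
∑-split-+ (suc a) b f =
  trans (cong (f 0 +ℤ_) (∑-split-+ a b (λ x → f (suc x)))) (sym (ℤP.+-assoc (f 0) _ _))

∑-split-* : ∀ a c (f : ℕ → ℤ) → ∑ (a * c) f ≡ ∑ a (λ i → ∑ c (λ e → f (i * c + e)))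
∑-split-* zero    c f = refl
∑-split-* (suc a) c f = trans (∑-split-+ c (a * c) f) (cong (∑ c f +ℤ_) (begin
  ∑ (a * c) (λ x → f (c + x))
    ≡⟨ ∑-split-* a c (λ x → f (c + x)) ⟩
  ∑ a (λ i → ∑ c (λ e → f (c + (i * c + e))))
    ≡⟨ ∑-cong a (λ i → ∑-cong c (λ e → sym (cong f (+-assoc c (i * c) e)))) ⟩
  ∑ a (λ i → ∑ c (λ e → f (suc i * c + e))) ∎))
  where open ≡-Reasoning

∑-comm : ∀ A B (f : ℕ → ℕ → ℤ) → ∑ A (λ a → ∑ B (f a)) ≡ ∑ B (λ b → ∑ A (λ a → f a b))
∑-comm zero    B f = sym (∑-zero B)
∑-comm (suc A) B f =
  trans (cong (∑ B (f 0) +ℤ_) (∑-comm A B (λ a → f (suc a)))) (sym (∑-distrib-+ B (f 0) _))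

select : Bool → ℤ → ℤ
select b z = if b then z else 0ℤ

select-<ᵇ : ∀ {y N} z → y < N → select (y <ᵇ N) z ≡ z
select-<ᵇ z y<N rewrite Equivalence.to T-≡ (<⇒<ᵇ y<N) = refl

∑-select-≡ᵇ : ∀ N y (g : ℕ → ℤ) → ∑ N (λ x → select (x ≡ᵇ y) (g x)) ≡ select (y <ᵇ N) (g y)
∑-select-≡ᵇ zero    y       g = refl
∑-select-≡ᵇ (suc N) zero    g = trans (cong (g 0 +ℤ_) (∑-zero N)) (ℤP.+-identityʳ _)
∑-select-≡ᵇ (suc N) (suc y) g = trans (ℤP.+-identityˡ _) (∑-select-≡ᵇ N y (λ x → g (suc x)))

∑-select-≡ᵇ-< : ∀ {N y} (g : ℕ → ℤ) → y < N → ∑ N (λ x → select (x ≡ᵇ y) (g x)) ≡ g y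
∑-select-≡ᵇ-< {N} {y} g y<N = trans (∑-select-≡ᵇ N y g) (select-<ᵇ (g y) y<N)

≡ᵇ≡true⇔≡ : ∀ {x y} → ((x ≡ᵇ y) ≡ true) ⇔ (x ≡ y)
≡ᵇ≡true⇔≡ {x} {y} = mk⇔ (≡ᵇ⇒≡ x y ∘ Equivalence.from T-≡) (Equivalence.to T-≡ ∘ ≡⇒≡ᵇ x y)

≡ᵇ-cong-⇔ : ∀ {a b c e} → (a ≡ b ⇔ c ≡ e) → (a ≡ᵇ b) ≡ (c ≡ᵇ e)
≡ᵇ-cong-⇔ {a} {b} {c} {e} a≡b⇔c≡e with a ≡ᵇ b in ab | c ≡ᵇ e in ce
... | true  | true  = refl
... | false | false = refl
... | true  | false = contradiction
  (trans (sym (Equivalence.from ≡ᵇ≡true⇔≡ (Equivalence.to a≡b⇔c≡e (Equivalence.to ≡ᵇ≡true⇔≡ ab)))) ce) λ ()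
... | false | true  = contradiction
  (trans (sym (Equivalence.from ≡ᵇ≡true⇔≡ (Equivalence.from a≡b⇔c≡e (Equivalence.to ≡ᵇ≡true⇔≡ ce)))) ab) λ ()

occupancy : Maybe ℤ → ℤ
occupancy (just _) = 1ℤ
occupancy nothing  = 0ℤ

sumℤ-catMaybes-tabulate : ∀ N (G : ℕ → Maybe ℤ) →
  sumℤ (catMaybes (tabulate {n = N} (G ∘ toℕ))) ≡ ∑ N (fromMaybe 0ℤ ∘ G)
sumℤ-catMaybes-tabulate zero    G = refl
sumℤ-catMaybes-tabulate (suc N) G with G 0
... | just z  = cong (z +ℤ_) (sumℤ-catMaybes-tabulate N (G ∘ suc))
... | nothing = trans (sumℤ-catMaybes-tabulate N (G ∘ suc)) (sym (ℤP.+-identityˡ _))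

length-catMaybes-tabulate : ∀ N (G : ℕ → Maybe ℤ) →
  + length (catMaybes (tabulate {n = N} (G ∘ toℕ))) ≡ ∑ N (occupancy ∘ G)
length-catMaybes-tabulate zero    G = refl
length-catMaybes-tabulate (suc N) G with G 0
... | just _  = cong (1ℤ +ℤ_) (length-catMaybes-tabulate N (G ∘ suc))
... | nothing = trans (length-catMaybes-tabulate N (G ∘ suc)) (sym (ℤP.+-identityˡ _))

sumℤ-mapMaybe-allFin : ∀ N (G : ℕ → Maybe ℤ) →
  sumℤ (mapMaybe (G ∘ toℕ) (allFin N)) ≡ ∑ N (fromMaybe 0ℤ ∘ G)
sumℤ-mapMaybe-allFin N G =
  trans (cong (sumℤ ∘ catMaybes) (map-tabulate {n = N} (λ j → j) (G ∘ toℕ))) (sumℤ-catMaybes-tabulate N G)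

length-mapMaybe-allFin : ∀ N (G : ℕ → Maybe ℤ) →
  + length (mapMaybe (G ∘ toℕ) (allFin N)) ≡ ∑ N (occupancy ∘ G)
length-mapMaybe-allFin N G =
  trans (cong (+_ ∘ length ∘ catMaybes) (map-tabulate {n = N} (λ j → j) (G ∘ toℕ))) (length-catMaybes-tabulate N G)

≡[mod]-refl : ∀ e v → e ≡ e [mod v ]
≡[mod]-refl e v = subst (v ∣_) (sym (cong ℤ.∣_∣ (ℤP.+-inverseʳ e))) (v ∣0)

+≡-[mod]-complement : ∀ {x y v} → y + x ≡ v → (+ y) ≡ - (+ x) [mod v ]
+≡-[mod]-complement {x} {y} {v} y+x≡v =
  subst (v ∣_) (sym (cong ℤ.∣_∣ (trans (cong (+ y +ℤ_) (ℤP.neg-involutive (+ x))) (cong +_ y+x≡v)))) ∣-refl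

-≡+[mod]-complement : ∀ {x y v} → y + x ≡ v → (- (+ y)) ≡ (+ x) [mod v ]
-≡+[mod]-complement {x} {y} {v} y+x≡v = subst (v ∣_) (sym |-y-x|≡v) ∣-refl
  where
  |-y-x|≡v : ℤ.∣ - + y +ℤ - + x ∣ ≡ v
  |-y-x|≡v = begin
    ℤ.∣ - + y +ℤ - + x ∣   ≡⟨ cong ℤ.∣_∣ (ℤP.neg-distrib-+ (+ y) (+ x)) ⟨
    ℤ.∣ - (+ (y + x)) ∣    ≡⟨ ℤP.∣-i∣≡∣i∣ (+ (y + x)) ⟩
    y + x                  ≡⟨ y+x≡v ⟩
    v                      ∎
    where open ≡-Reasoning

module CyclicShift (n : ℕ) .{{_ : NonZero n}} where

  shift : ℕ → ℕ → ℕ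
  shift c x = (x + c) % n

  -- The inverse of shift c on [0, n); the offset n ∸ c % n avoids truncated subtraction.
  unshift : ℕ → ℕ → ℕ
  unshift c y = (y + (n ∸ c % n)) % n

  shift-< : ∀ c x → shift c x < n
  shift-< c x = m%n<n (x + c) n

  unshift-< : ∀ c y → unshift c y < n
  unshift-< c y = m%n<n (y + (n ∸ c % n)) n

  [m%n+o]%n≡[m+o]%n : ∀ x c → (x % n + c) % n ≡ (x + c) % n
  [m%n+o]%n≡[m+o]%n x c = begin
    (x % n + c) % n           ≡⟨ %-distribˡ-+ (x % n) c n ⟩
    (x % n % n + c % n) % n   ≡⟨ cong (λ z → (z + c % n) % n) (m%n%n≡m%n x n) ⟩
    (x % n + c % n) % n       ≡⟨ %-distribˡ-+ x c n ⟨
    (x + c) % n               ∎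
    where open ≡-Reasoning

  [m+o%n]%n≡[m+o]%n : ∀ x c → (x + c % n) % n ≡ (x + c) % n
  [m+o%n]%n≡[m+o]%n x c = begin
    (x + c % n) % n   ≡⟨ cong (_% n) (+-comm x (c % n)) ⟩
    (c % n + x) % n   ≡⟨ [m%n+o]%n≡[m+o]%n c x ⟩
    (c + x) % n       ≡⟨ cong (_% n) (+-comm c x) ⟩
    (x + c) % n       ∎
    where open ≡-Reasoning

  shift-unshift : ∀ c {y} → y < n → shift c (unshift c y) ≡ y
  shift-unshift c {y} y<n = begin
    ((y + r) % n + c) % n     ≡⟨ [m%n+o]%n≡[m+o]%n (y + r) c ⟩
    (y + r + c) % n           ≡⟨ [m+o%n]%n≡[m+o]%n (y + r) c ⟨
    (y + r + c % n) % n       ≡⟨ cong (_% n) (+-assoc y r (c % n)) ⟩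
    (y + (r + c % n)) % n     ≡⟨ cong (λ z → (y + z) % n) (m∸n+n≡m (m%n≤n c n)) ⟩
    (y + n) % n               ≡⟨ [m+n]%n≡m%n y n ⟩
    y % n                     ≡⟨ m<n⇒m%n≡m y<n ⟩
    y                         ∎
    where
    open ≡-Reasoning
    r = n ∸ c % n

  unshift-shift : ∀ c {x} → x < n → unshift c (shift c x) ≡ x
  unshift-shift c {x} x<n = begin
    ((x + c) % n + r) % n     ≡⟨ [m%n+o]%n≡[m+o]%n (x + c) r ⟩
    (x + c + r) % n           ≡⟨ cong (_% n) (xy∙z≈xz∙y x c r) ⟩
    (x + r + c) % n           ≡⟨ [m+o%n]%n≡[m+o]%n (x + r) c ⟨
    (x + r + c % n) % n       ≡⟨ cong (_% n) (+-assoc x r (c % n)) ⟩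
    (x + (r + c % n)) % n     ≡⟨ cong (λ z → (x + z) % n) (m∸n+n≡m (m%n≤n c n)) ⟩
    (x + n) % n               ≡⟨ [m+n]%n≡m%n x n ⟩
    x % n                     ≡⟨ m<n⇒m%n≡m x<n ⟩
    x                         ∎
    where
    open ≡-Reasoning
    r = n ∸ c % n

  unshift-0 : ∀ {y} → y < n → unshift 0 y ≡ y
  unshift-0 {y} y<n = trans (cong (unshift 0) (sym shift-0)) (unshift-shift 0 y<n)
    where
    shift-0 : shift 0 y ≡ y
    shift-0 = trans (cong (_% n) (+-identityʳ y)) (m<n⇒m%n≡m y<n)

  unshift⇔shift : ∀ c {x y} → x < n → y < n → (x ≡ unshift c y) ⇔ (shift c x ≡ y)
  unshift⇔shift c x<n y<n = mk⇔ (λ { refl → shift-unshift c y<n }) (λ { refl → sym (unshift-shift c x<n) })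

  shift-shift : ∀ c c′ x → shift c′ (shift c x) ≡ shift (c + c′) x
  shift-shift c c′ x = trans ([m%n+o]%n≡[m+o]%n (x + c) c′) (cong (_% n) (+-assoc x c c′))

  shift-unshift-+ : ∀ c c′ {y} → y < n → shift c (unshift (c + c′) y) ≡ unshift c′ y
  shift-unshift-+ c c′ {y} y<n = begin
    shift c z                           ≡⟨ unshift-shift c′ (shift-< c z) ⟨
    unshift c′ (shift c′ (shift c z))   ≡⟨ cong (unshift c′) (shift-shift c c′ z) ⟩
    unshift c′ (shift (c + c′) z)       ≡⟨ cong (unshift c′) (shift-unshift (c + c′) y<n) ⟩
    unshift c′ y                        ∎
    where
    open ≡-Reasoning
    z = unshift (c + c′) y

  shift-*n+ : ∀ c b x → shift c (b * n + x) ≡ shift c x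
  shift-*n+ c b x = begin
    (b * n + x + c) % n     ≡⟨ cong (_% n) (xy∙z≈zy∙x (b * n) x c) ⟩
    (c + x + b * n) % n     ≡⟨ [m+kn]%n≡m%n (c + x) b n ⟩
    (c + x) % n             ≡⟨ cong (_% n) (+-comm c x) ⟩
    (x + c) % n             ∎
    where open ≡-Reasoning

  ∑-unshift-window : ∀ c {S} (F : ℕ → ℤ) → S ≤ n →
    ∑ n (λ y → select (unshift c y <ᵇ S) (F (unshift c y))) ≡ ∑ S F
  ∑-unshift-window c {S} F S≤n = begin
    ∑ n (λ y → select (unshift c y <ᵇ S) (F (unshift c y)))
      ≡⟨ ∑-cong n (λ y → sym (∑-select-≡ᵇ S (unshift c y) F)) ⟩
    ∑ n (λ y → ∑ S (λ x → select (x ≡ᵇ unshift c y) (F x)))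
      ≡⟨ ∑-comm n S _ ⟩
    ∑ S (λ x → ∑ n (λ y → select (x ≡ᵇ unshift c y) (F x)))
      ≡⟨ ∑-cong-< S (λ x x<S → column x (≤-trans x<S S≤n)) ⟩
    ∑ S F ∎
    where
    open ≡-Reasoning
    column : ∀ x → x < n → ∑ n (λ y → select (x ≡ᵇ unshift c y) (F x)) ≡ F x
    column x x<n = begin
      ∑ n (λ y → select (x ≡ᵇ unshift c y) (F x))
        ≡⟨ ∑-cong-< n (λ y y<n → cong (λ b → select b (F x)) (≡ᵇ-cong-⇔ (unshift⇔shift c x<n y<n))) ⟩
      ∑ n (λ y → select (shift c x ≡ᵇ y) (F x))
        ≡⟨ ∑-cong n (λ y → cong (λ b → select b (F x)) (≡ᵇ-cong-⇔ {shift c x} {y} (mk⇔ sym sym))) ⟩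
      ∑ n (λ y → select (y ≡ᵇ shift c x) (F x))
        ≡⟨ ∑-select-≡ᵇ-< (λ _ → F x) (shift-< c x) ⟩
      F x ∎

  ∑-shift-fibre : ∀ c κ {y} (F : ℕ → ℤ) → y < n →
    ∑ (κ * n) (λ ρ → select (shift c ρ ≡ᵇ y) (F ρ)) ≡ ∑ κ (λ b → F (b * n + unshift c y))
  ∑-shift-fibre c κ {y} F y<n = trans (∑-split-* κ n _) (∑-cong κ block)
    where
    open ≡-Reasoning
    block : ∀ b → ∑ n (λ x → select (shift c (b * n + x) ≡ᵇ y) (F (b * n + x))) ≡ F (b * n + unshift c y)
    block b = begin
      ∑ n (λ x → select (shift c (b * n + x) ≡ᵇ y) (F (b * n + x)))
        ≡⟨ ∑-cong-< n (λ x x<n → cong (λ z → select z (F (b * n + x)))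
             (trans (cong (_≡ᵇ y) (shift-*n+ c b x)) (≡ᵇ-cong-⇔ (⇔-sym (unshift⇔shift c x<n y<n))))) ⟩
      ∑ n (λ x → select (x ≡ᵇ unshift c y) (F (b * n + x)))
        ≡⟨ ∑-select-≡ᵇ-< (λ x → F (b * n + x)) (unshift-< c y) ⟩
      F (b * n + unshift c y) ∎

  blockShift : ℕ → ℕ → ℕ
  blockShift c ρ = ρ / n * n + shift c (ρ % n)

  blockUnshift : ℕ → ℕ → ℕ
  blockUnshift c ρ = ρ / n * n + unshift c (ρ % n)

  blockShift-*n+ : ∀ c b {x} → x < n → blockShift c (b * n + x) ≡ b * n + shift c x
  blockShift-*n+ c b x<n = cong₂ (λ b′ x′ → b′ * n + shift c x′) ([m*n+o]/n≡m b x<n) ([m*n+o]%n≡o b x<n)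

  blockShift-blockUnshift : ∀ c ρ → blockShift c (blockUnshift c ρ) ≡ ρ
  blockShift-blockUnshift c ρ = begin
    blockShift c (ρ / n * n + unshift c (ρ % n))  ≡⟨ blockShift-*n+ c (ρ / n) (unshift-< c (ρ % n)) ⟩
    ρ / n * n + shift c (unshift c (ρ % n))       ≡⟨ cong (_+_ (ρ / n * n)) (shift-unshift c (m%n<n ρ n)) ⟩
    ρ / n * n + ρ % n                             ≡⟨ +-comm (ρ / n * n) (ρ % n) ⟩
    ρ % n + ρ / n * n                             ≡⟨ m≡m%n+[m/n]*n ρ n ⟨
    ρ                                             ∎
    where open ≡-Reasoning

  blockShift-< : ∀ c {κ ρ} → ρ < κ * n → blockShift c ρ < κ * n
  blockShift-< c {κ} ρ<κn = radix-< (m<n*o⇒m/o<n {n = κ} ρ<κn) (shift-< c _)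

  blockUnshift-< : ∀ c {κ ρ} → ρ < κ * n → blockUnshift c ρ < κ * n
  blockUnshift-< c {κ} ρ<κn = radix-< (m<n*o⇒m/o<n {n = κ} ρ<κn) (unshift-< c _)

quadruple-cancel : ∀ x y → x +ℤ (- (x +ℤ + 1) +ℤ (- y +ℤ ((y +ℤ + 1) +ℤ + 0))) ≡ + 0
quadruple-cancel = solveℤ-∀

crossed-quadruples-cancel : ∀ x y k → x +ℤ (- (y +ℤ + 1) +ℤ (- (x +ℤ k) +ℤ ((y +ℤ k +ℤ + 1) +ℤ + 0))) ≡ + 0
crossed-quadruples-cancel = solveℤ-∀

module Construction (m n σ κ τ q : ℕ) .{{_ : NonZero n}} .{{_ : NonZero σ}} .{{_ : NonZero q}}
    (mσ≡κn : m * σ ≡ κ * n) (τq≡mσ : τ * q ≡ m * σ) (4σ≤n : 4 * σ ≤ n) where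

  open CyclicShift n

  d : ℕ
  d = suc (2 * q)

  K : ℕ
  K = τ * d

  a : ℕ → ℕ
  a π = suc (π / q * d + 2 * (π % q))

  β : ℕ → ℕ
  β = blockShift (2 * σ)

  entry : ℕ → ℕ → ℤ
  entry ρ 0 = + a ρ
  entry ρ 1 = - (+ a ρ +ℤ 1ℤ)
  entry ρ 2 = - (+ a (β ρ) +ℤ + K)
  entry ρ 3 = + a (β ρ) +ℤ + K +ℤ 1ℤ
  entry ρ (suc (suc (suc (suc _)))) = 0ℤ

  offset : ℕ → ℕ → ℕ
  offset i J = unshift (i * σ) J

  atOffset : (ℕ → ℕ → ℤ) → ℕ → ℕ → ℤ
  atOffset U i D = U (i * σ + D % σ) (D / σ)

  cell : ℕ → ℕ → Maybe ℤ
  cell i J = if offset i J <ᵇ 4 * σ then just (atOffset entry i (offset i J)) else nothing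

  spread : (ℕ → ℕ → ℤ) → ℕ → ℕ → ℤ
  spread U i J = select (offset i J <ᵇ 4 * σ) (atOffset U i (offset i J))

  fromMaybe-cell : ∀ i J → fromMaybe 0ℤ (cell i J) ≡ spread entry i J
  fromMaybe-cell i J with offset i J <ᵇ 4 * σ
  ... | true  = refl
  ... | false = refl

  occupancy-cell : ∀ i J → occupancy (cell i J) ≡ spread (λ _ _ → 1ℤ) i J
  occupancy-cell i J with offset i J <ᵇ 4 * σ
  ... | true  = refl
  ... | false = refl

  atOffset-digits : ∀ U i r {e} → e < σ → atOffset U i (r * σ + e) ≡ U (i * σ + e) r
  atOffset-digits U i r e<σ =
    cong₂ (λ x y → U (i * σ + x) y) ([m*n+o]%n≡o r e<σ) ([m*n+o]/n≡m r e<σ)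

  ∑-spread-row : ∀ U i → ∑ n (spread U i) ≡ ∑ σ (λ e → ∑ 4 (U (i * σ + e)))
  ∑-spread-row U i = begin
    ∑ n (spread U i)                                   ≡⟨ ∑-unshift-window (i * σ) (atOffset U i) 4σ≤n ⟩
    ∑ (4 * σ) (atOffset U i)                           ≡⟨ ∑-split-* 4 σ _ ⟩
    ∑ 4 (λ r → ∑ σ (λ e → atOffset U i (r * σ + e)))   ≡⟨ ∑-cong 4 (λ r → ∑-cong-< σ (λ e → atOffset-digits U i r)) ⟩
    ∑ 4 (λ r → ∑ σ (λ e → U (i * σ + e) r))            ≡⟨ ∑-comm 4 σ (λ r e → U (i * σ + e) r) ⟩
    ∑ σ (λ e → ∑ 4 (U (i * σ + e)))                    ∎
    where open ≡-Reasoning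

  spread-by-position : ∀ U i {J} → J < n → spread U i J ≡
    ∑ 4 (λ r → ∑ σ (λ e → select (shift (r * σ) (i * σ + e) ≡ᵇ J) (U (i * σ + e) r)))
  spread-by-position U i {J} J<n = begin
    spread U i J
      ≡⟨ ∑-select-≡ᵇ (4 * σ) (offset i J) (atOffset U i) ⟨
    ∑ (4 * σ) (λ D → select (D ≡ᵇ offset i J) (atOffset U i D))
      ≡⟨ ∑-cong-< (4 * σ) (λ D D<4σ → cong (λ b → select b (atOffset U i D))
           (≡ᵇ-cong-⇔ (unshift⇔shift (i * σ) (≤-trans D<4σ 4σ≤n) J<n))) ⟩
    ∑ (4 * σ) (λ D → select (shift (i * σ) D ≡ᵇ J) (atOffset U i D))
      ≡⟨ ∑-split-* 4 σ _ ⟩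
    ∑ 4 (λ r → ∑ σ (λ e → select (shift (i * σ) (r * σ + e) ≡ᵇ J) (atOffset U i (r * σ + e))))
      ≡⟨ ∑-cong 4 (λ r → ∑-cong-< σ (λ e e<σ →
           cong₂ (λ x z → select (x % n ≡ᵇ J) z) (xy∙z≈zy∙x (r * σ) e (i * σ)) (atOffset-digits U i r e<σ))) ⟩
    ∑ 4 (λ r → ∑ σ (λ e → select (shift (r * σ) (i * σ + e) ≡ᵇ J) (U (i * σ + e) r)))
      ∎
    where open ≡-Reasoning

  ∑-spread-column : ∀ U {J} → J < n →
    ∑ m (λ i → spread U i J) ≡ ∑ κ (λ b → ∑ 4 (λ r → U (b * n + unshift (r * σ) J) r))
  ∑-spread-column U {J} J<n = begin
    ∑ m (λ i → spread U i J)
      ≡⟨ ∑-cong m (λ i → spread-by-position U i J<n) ⟩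
    ∑ m (λ i → ∑ 4 (λ r → ∑ σ (λ e → T r (i * σ + e))))
      ≡⟨ ∑-comm m 4 (λ i r → ∑ σ (λ e → T r (i * σ + e))) ⟩
    ∑ 4 (λ r → ∑ m (λ i → ∑ σ (λ e → T r (i * σ + e))))
      ≡⟨ ∑-cong 4 (λ r → trans (sym (∑-split-* m σ (T r))) (cong (λ N → ∑ N (T r)) mσ≡κn)) ⟩
    ∑ 4 (λ r → ∑ (κ * n) (T r))
      ≡⟨ ∑-cong 4 (λ r → ∑-shift-fibre (r * σ) κ (λ ρ → U ρ r) J<n) ⟩
    ∑ 4 (λ r → ∑ κ (λ b → U (b * n + unshift (r * σ) J) r))
      ≡⟨ ∑-comm 4 κ (λ r b → U (b * n + unshift (r * σ) J) r) ⟩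
    ∑ κ (λ b → ∑ 4 (λ r → U (b * n + unshift (r * σ) J) r)) ∎
    where
    open ≡-Reasoning
    T : ℕ → ℕ → ℤ
    T r ρ = select (shift (r * σ) ρ ≡ᵇ J) (U ρ r)

  quadruple-sum : ∀ ρ → ∑ 4 (entry ρ) ≡ 0ℤ
  quadruple-sum ρ = quadruple-cancel (+ a ρ) (+ a (β ρ) +ℤ + K)

  column-quadruple-sum : ∀ b {J} → J < n → ∑ 4 (λ r → entry (b * n + unshift (r * σ) J) r) ≡ 0ℤ
  column-quadruple-sum b {J} J<n = begin
    ∑ 4 (λ r → entry (b * n + unshift (r * σ) J) r)
      ≡⟨ cong₂ (λ ρ ρ′ → + a ρ₀ +ℤ (- (+ a ρ₁ +ℤ 1ℤ) +ℤ (- (+ a ρ +ℤ + K) +ℤ (+ a ρ′ +ℤ + K +ℤ 1ℤ +ℤ 0ℤ))))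
           β-ρ₂ β-ρ₃ ⟩
    + a ρ₀ +ℤ (- (+ a ρ₁ +ℤ 1ℤ) +ℤ (- (+ a ρ₀ +ℤ + K) +ℤ (+ a ρ₁ +ℤ + K +ℤ 1ℤ +ℤ 0ℤ)))
      ≡⟨ crossed-quadruples-cancel (+ a ρ₀) (+ a ρ₁) (+ K) ⟩
    0ℤ ∎
    where
    open ≡-Reasoning
    ρ₀ ρ₁ : ℕ
    ρ₀ = b * n + unshift 0 J
    ρ₁ = b * n + unshift (1 * σ) J
    β-ρ₂ : β (b * n + unshift (2 * σ) J) ≡ ρ₀
    β-ρ₂ = begin
      β (b * n + unshift (2 * σ) J)
        ≡⟨ blockShift-*n+ (2 * σ) b (unshift-< (2 * σ) J) ⟩
      b * n + shift (2 * σ) (unshift (2 * σ) J)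
        ≡⟨ cong (_+_ (b * n)) (shift-unshift (2 * σ) J<n) ⟩
      b * n + J
        ≡⟨ cong (_+_ (b * n)) (unshift-0 J<n) ⟨
      ρ₀ ∎
    β-ρ₃ : β (b * n + unshift (3 * σ) J) ≡ ρ₁
    β-ρ₃ = begin
      β (b * n + unshift (3 * σ) J)
        ≡⟨ blockShift-*n+ (2 * σ) b (unshift-< (3 * σ) J) ⟩
      b * n + shift (2 * σ) (unshift (3 * σ) J)
        ≡⟨ cong (λ c → b * n + shift (2 * σ) (unshift c J)) (*-distribʳ-+ σ 2 1) ⟩
      b * n + shift (2 * σ) (unshift (2 * σ + 1 * σ) J)
        ≡⟨ cong (_+_ (b * n)) (shift-unshift-+ (2 * σ) (1 * σ) J<n) ⟩
      ρ₁ ∎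

  row-sum : ∀ i → ∑ n (fromMaybe 0ℤ ∘ cell i) ≡ 0ℤ
  row-sum i = begin
    ∑ n (fromMaybe 0ℤ ∘ cell i)            ≡⟨ ∑-cong n (fromMaybe-cell i) ⟩
    ∑ n (spread entry i)                   ≡⟨ ∑-spread-row entry i ⟩
    ∑ σ (λ e → ∑ 4 (entry (i * σ + e)))    ≡⟨ ∑-cong σ (λ e → quadruple-sum (i * σ + e)) ⟩
    ∑ σ (λ _ → 0ℤ)                         ≡⟨ ∑-zero σ ⟩
    0ℤ                                     ∎
    where open ≡-Reasoning

  row-length : ∀ i → ∑ n (occupancy ∘ cell i) ≡ + (σ * 4)
  row-length i = begin
    ∑ n (occupancy ∘ cell i)               ≡⟨ ∑-cong n (occupancy-cell i) ⟩
    ∑ n (spread (λ _ _ → 1ℤ) i)            ≡⟨ ∑-spread-row (λ _ _ → 1ℤ) i ⟩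
    ∑ σ (λ _ → + 4)                        ≡⟨ ∑-const σ 4 ⟩
    + (σ * 4)                              ∎
    where open ≡-Reasoning

  column-sum : ∀ {J} → J < n → ∑ m (λ i → fromMaybe 0ℤ (cell i J)) ≡ 0ℤ
  column-sum {J} J<n = begin
    ∑ m (λ i → fromMaybe 0ℤ (cell i J))    ≡⟨ ∑-cong m (λ i → fromMaybe-cell i J) ⟩
    ∑ m (λ i → spread entry i J)           ≡⟨ ∑-spread-column entry J<n ⟩
    ∑ κ (λ b → ∑ 4 (λ r → entry (b * n + unshift (r * σ) J) r))
                                           ≡⟨ ∑-cong κ (λ b → column-quadruple-sum b J<n) ⟩
    ∑ κ (λ _ → 0ℤ)                         ≡⟨ ∑-zero κ ⟩
    0ℤ                                     ∎
    where open ≡-Reasoning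

  column-length : ∀ {J} → J < n → ∑ m (λ i → occupancy (cell i J)) ≡ + (κ * 4)
  column-length {J} J<n = begin
    ∑ m (λ i → occupancy (cell i J))       ≡⟨ ∑-cong m (λ i → occupancy-cell i J) ⟩
    ∑ m (λ i → spread (λ _ _ → 1ℤ) i J)    ≡⟨ ∑-spread-column (λ _ _ → 1ℤ) J<n ⟩
    ∑ κ (λ _ → + 4)                        ≡⟨ ∑-const κ 4 ⟩
    + (κ * 4)                              ∎
    where open ≡-Reasoning

  a-*q+ : ∀ j {h} → h < q → a (j * q + h) ≡ suc (j * d + 2 * h)
  a-*q+ j h<q = cong₂ (λ x y → suc (x * d + 2 * y)) ([m*n+o]/n≡m j h<q) ([m*n+o]%n≡o j h<q)

  a-< : ∀ {π} → π < τ * q → a π < K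
  a-< {π} π<τq = subst (_< K) (+-suc (π / q * d) (2 * (π % q)))
    (radix-< {h = suc (2 * (π % q))} (m<n*o⇒m/o<n {n = τ} π<τq) (s<s (*-monoʳ-< 2 (m%n<n π q))))

  a-surjective : ∀ y → y < K → ¬ d ∣ y → ∃ λ π → π < τ * q × (y ≡ a π ⊎ y ≡ suc (a π))
  a-surjective y y<K d∤y with y % d in y%d≡ | m%n<n y d
  ... | zero  | _     = contradiction (m%n≡0⇒n∣m y d y%d≡) d∤y
  ... | suc u | u<2q  = π , radix-< j<τ h<q , parity (u % 2) (m%n<n u 2) y≡u%2+aπ
    where
    open ≡-Reasoning
    j h π : ℕ
    j = y / d
    h = u / 2
    π = j * q + h
    j<τ : j < τ
    j<τ = m<n*o⇒m/o<n y<K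
    h<q : h < q
    h<q = m<n*o⇒m/o<n (subst (u <_) (*-comm 2 q) (s<s⁻¹ u<2q))
    digits : ∀ p h j d → suc (p + h * 2) + j * d ≡ p + suc (j * d + 2 * h)
    digits = solve-∀
    y≡u%2+aπ : y ≡ u % 2 + a π
    y≡u%2+aπ = begin
      y                              ≡⟨ m≡m%n+[m/n]*n y d ⟩
      y % d + j * d                  ≡⟨ cong (_+ j * d) y%d≡ ⟩
      suc u + j * d                  ≡⟨ cong (λ x → suc x + j * d) (m≡m%n+[m/n]*n u 2) ⟩
      suc (u % 2 + h * 2) + j * d    ≡⟨ digits (u % 2) h j d ⟩
      u % 2 + suc (j * d + 2 * h)    ≡⟨ cong (_+_ (u % 2)) (a-*q+ j h<q) ⟨
      u % 2 + a π                    ∎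
    parity : ∀ p → p < 2 → y ≡ p + a π → y ≡ a π ⊎ y ≡ suc (a π)
    parity 0 _ e = inj₁ e
    parity 1 _ e = inj₂ e
    parity (suc (suc _)) (s≤s (s≤s ())) _

  β-< : ∀ {ρ} → ρ < m * σ → β ρ < τ * q
  β-< {ρ} ρ<mσ = subst (β ρ <_) (trans (sym mσ≡κn) (sym τq≡mσ)) (blockShift-< (2 * σ) {κ} (subst (ρ <_) mσ≡κn ρ<mσ))

  entry-bounds : ∀ {ρ} r → ρ < m * σ → r < 4 → 1 ≤ ℤ.∣ entry ρ r ∣ × ℤ.∣ entry ρ r ∣ ≤ K + K
  entry-bounds {ρ} 0 ρ<mσ _ = s≤s z≤n , ≤-trans (<⇒≤ (a-< (subst (ρ <_) (sym τq≡mσ) ρ<mσ))) (m≤m+n K K)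
  entry-bounds {ρ} 1 ρ<mσ _ =
    s≤s z≤n , ≤-trans (subst (_≤ K) (+-comm 1 (a ρ)) (a-< (subst (ρ <_) (sym τq≡mσ) ρ<mσ))) (m≤m+n K K)
  entry-bounds {ρ} 2 ρ<mσ _ = s≤s z≤n , +-monoˡ-≤ K (<⇒≤ (a-< (β-< ρ<mσ)))
  entry-bounds {ρ} 3 ρ<mσ _ = s≤s z≤n , subst (_≤ K + K) (sym (+1-comm (a (β ρ)) K)) (+-monoˡ-≤ K (a-< (β-< ρ<mσ)))
  entry-bounds (suc (suc (suc (suc _)))) _ (s≤s (s≤s (s≤s (s≤s ()))))

  cell-filled : ∀ i J → offset i J < 4 * σ → cell i J ≡ just (atOffset entry i (offset i J))
  cell-filled i J offset<4σ rewrite Equivalence.to T-≡ (<⇒<ᵇ offset<4σ) = refl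

  Appears : ℤ → Set
  Appears e = ∃ λ i → ∃ λ J → i < m × J < n × cell i J ≡ just e

  entry-appears : ∀ {ρ r e} → ρ < m * σ → r < 4 → entry ρ r ≡ e → Appears e
  entry-appears {ρ} {r} ρ<mσ r<4 refl = i , J , m<n*o⇒m/o<n {n = m} ρ<mσ , shift-< (i * σ) D , cell-iJ
    where
    open ≡-Reasoning
    i e D J : ℕ
    i = ρ / σ
    e = ρ % σ
    D = r * σ + e
    J = shift (i * σ) D
    D<4σ : D < 4 * σ
    D<4σ = radix-< r<4 (m%n<n ρ σ)
    offset≡D : offset i J ≡ D
    offset≡D = unshift-shift (i * σ) (≤-trans D<4σ 4σ≤n)
    cell-iJ : cell i J ≡ just (entry ρ r)
    cell-iJ = begin
      cell i J                        ≡⟨ cell-filled i J (subst (_< 4 * σ) (sym offset≡D) D<4σ) ⟩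
      just (atOffset entry i (offset i J))
                                      ≡⟨ cong (just ∘ atOffset entry i) offset≡D ⟩
      just (atOffset entry i D)       ≡⟨ cong just (atOffset-digits entry i r (m%n<n ρ σ)) ⟩
      just (entry (i * σ + e) r)      ≡⟨ cong (λ x → just (entry x r)) (+-comm (i * σ) e) ⟩
      just (entry (e + i * σ) r)      ≡⟨ cong (λ x → just (entry x r)) (m≡m%n+[m/n]*n ρ σ) ⟨
      just (entry ρ r)                ∎

  d∣K : d ∣ K
  d∣K = n∣m*n τ

  ±Appears : ℕ → Set
  ±Appears y = Appears (+ y) ⊎ Appears (- (+ y))

  β-surjective : ∀ {π} → π < τ * q → ∃ λ ρ → ρ < m * σ × β ρ ≡ π
  β-surjective {π} π<τq = blockUnshift (2 * σ) π ,
    subst (blockUnshift (2 * σ) π <_) (sym mσ≡κn) (blockUnshift-< (2 * σ) {κ} (subst (π <_) (trans τq≡mσ mσ≡κn) π<τq)) ,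
    blockShift-blockUnshift (2 * σ) π

  ±appears-below-K : ∀ {y} → y < K → ¬ d ∣ y → ±Appears y
  ±appears-below-K {y} y<K d∤y with a-surjective y y<K d∤y
  ... | π , π<τq , inj₁ refl = inj₁ (entry-appears (subst (π <_) τq≡mσ π<τq) (s≤s z≤n) refl)
  ... | π , π<τq , inj₂ refl =
    inj₂ (entry-appears (subst (π <_) τq≡mσ π<τq) (s≤s (s≤s z≤n)) (cong (λ x → - (+ x)) (+-comm (a π) 1)))

  ±appears-above-K : ∀ {y} → y < K → ¬ d ∣ y → ±Appears (y + K)
  ±appears-above-K {y} y<K d∤y with a-surjective y y<K d∤y
  ... | π , π<τq , y≡aπ⊎1+aπ with β-surjective π<τq
  ...   | ρ , ρ<mσ , refl with y≡aπ⊎1+aπ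
  ...     | inj₁ refl = inj₂ (entry-appears ρ<mσ (s≤s (s≤s (s≤s z≤n))) refl)
  ...     | inj₂ refl = inj₁ (entry-appears ρ<mσ (s≤s (s≤s (s≤s (s≤s z≤n)))) (cong +_ (+1-comm (a (β ρ)) K)))

  ±appears : ∀ {y} → y < K + K → ¬ d ∣ y → ±Appears y
  ±appears {y} y<2K d∤y with y <? K
  ... | yes y<K = ±appears-below-K y<K d∤y
  ... | no  y≮K = subst ±Appears y∸K+K≡y (±appears-above-K y∸K<K d∤y∸K)
    where
    y∸K+K≡y : y ∸ K + K ≡ y
    y∸K+K≡y = m∸n+n≡m (≮⇒≥ y≮K)
    y∸K<K : y ∸ K < K
    y∸K<K = +-cancelʳ-< K (y ∸ K) K (subst (_< K + K) (sym y∸K+K≡y) y<2K)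
    d∤y∸K : ¬ d ∣ y ∸ K
    d∤y∸K d∣y∸K = d∤y (subst (d ∣_) y∸K+K≡y (∣m∣n⇒∣m+n d∣y∸K d∣K))

  cell-bounds : ∀ {i J e} → i < m → cell i J ≡ just e → 1 ≤ ℤ.∣ e ∣ × ℤ.∣ e ∣ ≤ K + K
  cell-bounds {i} {J} i<m cell≡ with offset i J <ᵇ 4 * σ in offset<ᵇ4σ
  cell-bounds {i} {J} i<m refl | true =
    entry-bounds (D / σ) (radix-< i<m (m%n<n D σ)) (m<n*o⇒m/o<n {n = 4} (<ᵇ⇒< D (4 * σ) (Equivalence.from T-≡ offset<ᵇ4σ)))
    where D = offset i J
  cell-bounds i<m () | false

  v : ℕ
  v = 2 * m * (σ * 4) + τ * 4

  v≡τ4*d : v ≡ τ * 4 * d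
  v≡τ4*d = begin
    2 * m * (σ * 4) + τ * 4   ≡⟨ regroup m σ τ ⟩
    8 * (m * σ) + τ * 4       ≡⟨ cong (λ x → 8 * x + τ * 4) τq≡mσ ⟨
    8 * (τ * q) + τ * 4       ≡⟨ factor τ q ⟩
    τ * 4 * d                 ∎
    where
    open ≡-Reasoning
    regroup : ∀ m σ τ → 2 * m * (σ * 4) + τ * 4 ≡ 8 * (m * σ) + τ * 4
    regroup = solve-∀
    factor : ∀ τ q → 8 * (τ * q) + τ * 4 ≡ τ * 4 * suc (2 * q)
    factor = solve-∀

  v/2≡K+K : v / 2 ≡ K + K
  v/2≡K+K = trans (/-congˡ (trans v≡τ4*d (halve τ d))) (m*n/n≡m (K + K) 2)
    where
    halve : ∀ τ d → τ * 4 * d ≡ (τ * d + τ * d) * 2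
    halve = solve-∀

  ∉J⇒d∤ : ∀ {x} → ¬ InJ v (τ * 4) x → ¬ d ∣ x
  ∉J⇒d∤ {x} x∉J (divides c refl) = x∉J (divides c (trans (reorder τ c d) (cong (c *_) (sym v≡τ4*d))))
    where
    reorder : ∀ τ c d → τ * 4 * (c * d) ≡ c * (τ * 4 * d)
    reorder = solve-∀

  array : Fin m → Fin n → Maybe ℤ
  array i j = cell (toℕ i) (toℕ j)

  Covered : ℕ → Set
  Covered x = ∃ λ i → ∃ λ j → ∃ λ e → array i j ≡ just e × (e ≡ (+ x) [mod v ] ⊎ e ≡ - (+ x) [mod v ])

  appears⇒covered : ∀ {e x} → Appears e → (e ≡ (+ x) [mod v ] ⊎ e ≡ - (+ x) [mod v ]) → Covered x
  appears⇒covered {e} (i , J , i<m , J<n , cell≡) e≡±x = fromℕ< i<m , fromℕ< J<n , e ,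
    subst₂ (λ i′ J′ → cell i′ J′ ≡ just e) (sym (toℕ-fromℕ< i<m)) (sym (toℕ-fromℕ< J<n)) cell≡ , e≡±x

  covered-by-itself : ∀ {x} → ±Appears x → Covered x
  covered-by-itself {x} (inj₁ +x) = appears⇒covered +x (inj₁ (≡[mod]-refl (+ x) v))
  covered-by-itself {x} (inj₂ -x) = appears⇒covered -x (inj₂ (≡[mod]-refl (- (+ x)) v))

  covered-by-complement : ∀ {x y} → y + x ≡ v → ±Appears y → Covered x
  covered-by-complement {x} {y} y+x≡v (inj₁ +y) = appears⇒covered +y (inj₂ (+≡-[mod]-complement {x} {y} y+x≡v))
  covered-by-complement {x} {y} y+x≡v (inj₂ -y) = appears⇒covered -y (inj₁ (-≡+[mod]-complement {x} {y} y+x≡v))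

  covered : ∀ {x} → x < v → ¬ d ∣ x → Covered x
  covered {x} x<v d∤x with <-cmp x (K + K)
  ... | tri< x<2K _ _ = covered-by-itself (±appears x<2K d∤x)
  ... | tri≈ _ x≡2K _ = contradiction (subst (d ∣_) (sym x≡2K) (∣m∣n⇒∣m+n d∣K d∣K)) d∤x
  ... | tri> _ _ 2K<x = covered-by-complement y+x≡v (±appears y<2K d∤y)
    where
    y = v ∸ x
    y+x≡v : y + x ≡ v
    y+x≡v = m∸n+n≡m (<⇒≤ x<v)
    double : ∀ τ d → τ * 4 * d ≡ τ * d + τ * d + (τ * d + τ * d)
    double = solve-∀
    y<2K : y < K + K
    y<2K = +-cancelʳ-< x y (K + K) (begin-strict
      y + x             ≡⟨ y+x≡v ⟩
      v                 ≡⟨ trans v≡τ4*d (double τ d) ⟩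
      K + K + (K + K)   <⟨ +-monoʳ-< (K + K) 2K<x ⟩
      K + K + x         ∎)
      where open ≤-Reasoning
    d∤y : ¬ d ∣ y
    d∤y d∣y = d∤x (∣m+n∣m⇒∣n (subst (d ∣_) (trans (sym v≡τ4*d) (sym y+x≡v)) (n∣m*n (τ * 4))) d∣y)

  heffter : IntegerHeffter m n (σ * 4) (κ * 4) (τ * 4)
  heffter = record
    { array         = array
    ; entries-range = λ i j e cell≡ → let bounds = cell-bounds (toℕ<n i) cell≡ in
        proj₁ bounds , subst (ℤ.∣ e ∣ ≤_) (sym v/2≡K+K) (proj₂ bounds)
    ; row-filled    = λ i → ℤP.+-injective (trans (length-mapMaybe-allFin n (cell (toℕ i))) (row-length (toℕ i)))
    ; col-filled    = λ j → ℤP.+-injective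
        (trans (length-mapMaybe-allFin m (λ i → cell i (toℕ j))) (column-length (toℕ<n j)))
    ; covers        = λ x x<v x∉J → covered x<v (∉J⇒d∤ x∉J)
    ; row-sum       = λ i → trans (sumℤ-mapMaybe-allFin n (cell (toℕ i))) (row-sum (toℕ i))
    ; col-sum       = λ j → trans (sumℤ-mapMaybe-allFin m (λ i → cell i (toℕ j))) (column-sum (toℕ<n j))
    }

lemma3p3 : (m n s k : ℕ) → 4 ≤ s → s ≤ n → 4 ≤ k → k ≤ m → m * s ≡ n * k →
    4 ∣ s → 4 ∣ k →
    (t : ℕ) → t ∣ m * s → 4 ∣ t → IntegerHeffter m n s k t
lemma3p3 m n s k 4≤s s≤n 4≤k k≤m ms≡nk (divides σ refl) (divides κ refl) t (divides q ms≡qt) (divides τ refl) =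
  Construction.heffter m n σ κ τ q (*4-cancel m σ n κ ms≡nk) (sym (*4-cancel m σ q τ ms≡qt))
    (subst (_≤ n) (*-comm σ 4) s≤n)
  where
  instance
    n≢0 : NonZero n
    n≢0 = >-nonZero (≤-trans (s≤s z≤n) (≤-trans 4≤s s≤n))
    σ≢0 : NonZero σ
    σ≢0 = >-nonZero (*-cancelʳ-< 4 0 σ (≤-trans (s≤s z≤n) 4≤s))
    q≢0 : NonZero q
    q≢0 = >-nonZero (*-cancelʳ-< t 0 q (subst (0 <_) ms≡qt (≤-trans (s≤s z≤n) (*-mono-≤ (≤-trans 4≤k k≤m) 4≤s))))
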